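{- Let $G$ be a finite simple graph that has closed isoperimetric nesting. Then $\mathrm{Hun}[G]=1+\max_k\{\mathrm{mun}[k]-k\}$.
   Context: For $S\subseteq V(G)$ let $N[S]=S\cup\{v: v \text{ adjacent to some vertex of } S\}$ (closed neighborhood). $\mathrm{mun}[k]=\min\{|N[W]|: W\subseteq V(G), |W|=k\}$, for $1\le k\le |V(G)|$. Deaf-rabbit game: a hunter strategy is a finite sequence $H=(H_1,\dots,H_m)$ of multisets of vertices; set $R_H(0)=V(G)$ and $R_H(i)=N[R_H(i-1)\setminus H_i]$ (the rabbit may also stay put); $H$ is winning if $R_H(i)=\emptyset$ for some $i$; $\mathrm{Hun}[G]$ is the minimum over winning strategies of $\max_i|H_i|$ (multiplicities counted). With $n=|V(G)|$, $G$ has closed isoperimetric nesting if there is a chain of vertex subsets $G_1,\dots,G_n$ with $|G_i|=i$, $G_i\subset G_{i+1}$, $|N[G_i]|=\mathrm{mun}[i]$, and $N[G_i]=G_{|N[G_i]|}$ for all $i$. -}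

module Defs where

open import Data.Nat using (ℕ; zero; suc; _⊓_; _⊔_; _≤_; _∸_; _+_)
open import Data.Bool using (Bool; true; false; _∧_; _∨_; not)
open import Data.Fin using (Fin; _≟_)
open import Data.Fin.Subset using (Subset; ∣_∣; _⊆_; ⊥; ⊤)
open import Data.Vec using (Vec; []; _∷_; tabulate; lookup)
open import Data.Bool.ListAction using (any)
open import Data.Product using (Σ; _×_; _,_)
open import Data.List using (List; []; _∷_; allFin; length; scanl; foldr; map)
open import Data.List.Relation.Unary.Any using (Any)
open import Relation.Binary.PropositionalEquality using (_≡_)
open import Relation.Nullary.Decidable using (⌊_⌋)

record Graph : Set where
  field
    n     : ℕ
    adj   : Fin n → Fin n → Bool
    sym   : ∀ u v → adj u v ≡ adj v u
    loopless : ∀ v → adj v v ≡ false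
open Graph public

N[_]_ : (G : Graph) → Subset (n G) → Subset (n G)
N[ G ] S = tabulate λ v →
  lookup S v ∨ any (λ u → lookup S u ∧ adj G u v) (allFin (n G))

allSubsets : (m : ℕ) → List (Subset m)
allSubsets zero = [] ∷ []
allSubsets (suc m) =
  Data.List._++_ (map (true ∷_) (allSubsets m)) (map (false ∷_) (allSubsets m))

-- Computed as a minimum over all
-- subsets of size k, starting from n (an upper bound of every |N[W]|,
-- so the result is the exact minimum whenever some W of size k exists).
mun : (G : Graph) → ℕ → ℕ
mun G k = foldr (λ W r → if-size W r) (n G) (allSubsets (n G))
  where
  if-size : Subset (n G) → ℕ → ℕ
  if-size W r with ⌊ Data.Nat._≟_ ∣ W ∣ k ⌋
  ... | true  = ∣ N[ G ] W ∣ ⊓ r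
  ... | false = r

maxUpTo : (ℕ → ℕ) → ℕ → ℕ
maxUpTo f zero = 0
maxUpTo f (suc m) = f (suc m) ⊔ maxUpTo f m

Strategy : Graph → Set
Strategy G = List (List (Fin (n G)))

removeShot : (G : Graph) → Subset (n G) → List (Fin (n G)) → Subset (n G)
removeShot G R H = tabulate λ v →
  lookup R v ∧ not (any (λ h → ⌊ h ≟ v ⌋) H)

step : (G : Graph) → Subset (n G) → List (Fin (n G)) → Subset (n G)
step G R H = N[ G ] (removeShot G R H)

rabbitSets : (G : Graph) → Strategy G → List (Subset (n G))
rabbitSets G H = scanl (step G) ⊤ H

Winning : (G : Graph) → Strategy G → Set
Winning G H = Any (λ R → R ≡ ⊥) (rabbitSets G H)

width : (G : Graph) → Strategy G → ℕ
width G H = foldr (λ Hi r → length Hi ⊔ r) 0 H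

IsHun : (G : Graph) → ℕ → Set
IsHun G h =
  Σ (Strategy G) (λ H → Winning G H × (width G H ≡ h))
  × (∀ (H : Strategy G) → Winning G H → h ≤ width G H)

-- closed isoperimetric nesting, with the chain G_1 ⊂ ... ⊂ G_n given by
-- a function Gs indexed by ℕ (only indices 1..n are constrained)
IsNesting : (G : Graph) → (ℕ → Subset (n G)) → Set
IsNesting G Gs =
  ∀ i → 1 ≤ i → i ≤ n G →
    (∣ Gs i ∣ ≡ i) × ((suc i ≤ n G → Gs i ⊆ Gs (suc i))
      × ((∣ N[ G ] (Gs i) ∣ ≡ mun G i)
      × (N[ G ] (Gs i) ≡ Gs ∣ N[ G ] (Gs i) ∣)))

HasClosedIsoperimetricNesting : Graph → Set
HasClosedIsoperimetricNesting G =
  Σ (ℕ → Subset (n G)) (IsNesting G)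

-- Let d = max_k (mun[k] − k), attained at k.  A hunter with at most d shots per
-- round cannot win: while |R| ≥ mun[k] = k + d, at least k vertices of R survive
-- the shots, and the closed neighbourhood of any k of them already has mun[k]
-- vertices.  With d + 1 shots, round j (for j = n, …, 1) shoots G_j ∖ G_{j−d−1}:
-- a rabbit set inside G_j is left inside G_{j−d−1}, whose closed neighbourhood
-- is G_{mun[j−d−1]} ⊆ G_{j−1} (closedness and mun[i] ≤ i + d), so after n rounds
-- it lies in G₀ = ∅.
module Submission where

open import Defs hiding (sym)
open import Data.Nat as ℕ
  using (ℕ; zero; suc; _+_; _∸_; _≤_; _<_; z≤n; s≤s; _≤′_; ≤′-refl; ≤′-step)
open import Data.Nat.Properties hiding (_≟_)
open import Data.Bool using (Bool; true; false; T; not; _∧_)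
open import Data.Bool.Properties using (T-≡; T-∧; T-∨)
open import Data.Bool.ListAction using (any)
open import Data.Fin as Fin using (Fin; _≟_)
open import Data.Fin.Subset
  using (Subset; inside; outside; ∣_∣; _∈_; _∉_; _⊆_; _∪_; _─_; ⁅_⁆; ⊥; ⊤)
open import Data.Fin.Subset.Properties
  using ( _∈?_; ∉⊥; ⊥⊆; ∣⊥∣≡0; ∣⊤∣≡n; ∣p∣≡n⇒p≡⊤; ∣⁅x⁆∣≡1; x∈⁅x⁆
        ; drop-∷-⊆; s⊆s; ⊆-refl; ⊆-trans; ⊆-antisym; ⊆-reflexive; p⊆q⇒∣p∣≤∣q∣
        ; x∈p∪q⁺; x∈p∧x∉q⇒x∈p─q)
open import Data.Vec using ([]; _∷_; here; there; tabulate; lookup)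
open import Data.Vec.Properties using (lookup∘tabulate; []=⇒lookup; lookup⇒[]=)
open import Data.List using (List; []; _∷_; length; map; foldr; scanl; allFin)
open import Data.List.Properties using (length-map)
open import Data.List.Membership.Propositional using (find; lose)
  renaming (_∈_ to _∈ₗ_; _∉_ to _∉ₗ_)
open import Data.List.Membership.Propositional.Properties
  using (∈-map⁺; ∈-++⁺ˡ; ∈-++⁺ʳ; ∈-allFin)
open import Data.List.Relation.Unary.Any as Any using (Any; here; there)
open import Data.List.Relation.Unary.Any.Properties using (any⁺; any⁻)
open import Data.Product using (∃-syntax; _×_; _,_; proj₁; proj₂)
open import Data.Sum using (_⊎_; inj₁; inj₂; [_,_]′)
open import Function using (_⇔_; mk⇔; Equivalence)
open import Relation.Binary.PropositionalEquality
  using (_≡_; _≢_; refl; sym; trans; cong; cong₂; subst; module ≡-Reasoning)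
open import Relation.Nullary using (¬_; yes; no; contradiction)
open import Relation.Nullary.Decidable using (⌊_⌋; toWitness; fromWitness)

open Equivalence using (to; from)

private
  variable
    m : ℕ
    x : Fin m
    p q : Subset m

∈⇔T-lookup : {x : Fin m} {p : Subset m} → x ∈ p ⇔ T (lookup p x)
∈⇔T-lookup {x = x} {p} =
  mk⇔ (λ x∈p → from T-≡ ([]=⇒lookup x∈p)) (λ t → lookup⇒[]= x p (to T-≡ t))

∈-tabulate : {f : Fin m → Bool} {x : Fin m} → x ∈ tabulate f ⇔ T (f x)
∈-tabulate {f = f} {x} = subst (λ b → x ∈ tabulate f ⇔ T b) (lookup∘tabulate f x) ∈⇔T-lookup

∈ₗ⇔T-any : {H : List (Fin m)} → x ∈ₗ H ⇔ T (any (λ h → ⌊ h ≟ x ⌋) H)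
∈ₗ⇔T-any = mk⇔ (λ x∈H → any⁺ _ (Any.map (λ x≡h → fromWitness (sym x≡h)) x∈H))
                (λ t → Any.map (λ t′ → sym (toWitness t′)) (any⁻ _ _ t))

∣p∪q∣≤∣p∣+∣q∣ : (p q : Subset m) → ∣ p ∪ q ∣ ≤ ∣ p ∣ + ∣ q ∣
∣p∪q∣≤∣p∣+∣q∣ []            []            = z≤n
∣p∪q∣≤∣p∣+∣q∣ (outside ∷ p) (outside ∷ q) = ∣p∪q∣≤∣p∣+∣q∣ p q
∣p∪q∣≤∣p∣+∣q∣ (outside ∷ p) (inside  ∷ q) =
  ≤-trans (s≤s (∣p∪q∣≤∣p∣+∣q∣ p q)) (≤-reflexive (sym (+-suc ∣ p ∣ ∣ q ∣)))
∣p∪q∣≤∣p∣+∣q∣ (inside  ∷ p) (outside ∷ q) = s≤s (∣p∪q∣≤∣p∣+∣q∣ p q)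
∣p∪q∣≤∣p∣+∣q∣ (inside  ∷ p) (inside  ∷ q) =
  s≤s (≤-trans (∣p∪q∣≤∣p∣+∣q∣ p q) (+-monoʳ-≤ ∣ p ∣ (n≤1+n ∣ q ∣)))

∣p─q∣≡∣p∣∸∣q∣ : q ⊆ p → ∣ p ─ q ∣ ≡ ∣ p ∣ ∸ ∣ q ∣
∣p─q∣≡∣p∣∸∣q∣ {q = q} {p = p} q⊆p =
  trans (sym (m+n∸n≡m ∣ p ─ q ∣ ∣ q ∣)) (cong (_∸ ∣ q ∣) (∣p─q∣+∣q∣≡∣p∣ q⊆p))
  where
  ∣p─q∣+∣q∣≡∣p∣ : ∀ {m} {q p : Subset m} → q ⊆ p → ∣ p ─ q ∣ + ∣ q ∣ ≡ ∣ p ∣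
  ∣p─q∣+∣q∣≡∣p∣ {q = []}          {p = []}          _   = refl
  ∣p─q∣+∣q∣≡∣p∣ {q = outside ∷ q} {p = outside ∷ p} q⊆p = ∣p─q∣+∣q∣≡∣p∣ (drop-∷-⊆ q⊆p)
  ∣p─q∣+∣q∣≡∣p∣ {q = outside ∷ q} {p = inside  ∷ p} q⊆p = cong suc (∣p─q∣+∣q∣≡∣p∣ (drop-∷-⊆ q⊆p))
  ∣p─q∣+∣q∣≡∣p∣ {q = inside  ∷ q} {p = inside  ∷ p} q⊆p =
    trans (+-suc ∣ p ─ q ∣ ∣ q ∣) (cong suc (∣p─q∣+∣q∣≡∣p∣ (drop-∷-⊆ q⊆p)))
  ∣p─q∣+∣q∣≡∣p∣ {q = inside  ∷ q} {p = outside ∷ p} q⊆p with () ← q⊆p here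

subset-ofSize : (p : Subset m) {k : ℕ} → k ≤ ∣ p ∣ → ∃[ q ] q ⊆ p × ∣ q ∣ ≡ k
subset-ofSize {m} p {zero} _ = ⊥ , ⊥⊆ , ∣⊥∣≡0 m
subset-ofSize (inside ∷ p) {suc k} (s≤s k≤∣p∣) =
  let q , q⊆p , ∣q∣≡k = subset-ofSize p k≤∣p∣ in inside ∷ q , s⊆s q⊆p , cong suc ∣q∣≡k
subset-ofSize (outside ∷ p) {suc k} k≤∣p∣ =
  let q , q⊆p , ∣q∣≡k = subset-ofSize p k≤∣p∣ in outside ∷ q , s⊆s q⊆p , ∣q∣≡k

elements : Subset m → List (Fin m)
elements []            = []
elements (inside  ∷ p) = Fin.zero ∷ map Fin.suc (elements p)
elements (outside ∷ p) = map Fin.suc (elements p)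

length-elements : (p : Subset m) → length (elements p) ≡ ∣ p ∣
length-elements []            = refl
length-elements (inside  ∷ p) = cong suc (trans (length-map Fin.suc (elements p)) (length-elements p))
length-elements (outside ∷ p) = trans (length-map Fin.suc (elements p)) (length-elements p)

∈-elements : x ∈ p → x ∈ₗ elements p
∈-elements {p = inside  ∷ p} here        = here refl
∈-elements {p = inside  ∷ p} (there x∈p) = there (∈-map⁺ Fin.suc (∈-elements x∈p))
∈-elements {p = outside ∷ p} (there x∈p) = ∈-map⁺ Fin.suc (∈-elements x∈p)

∈-allSubsets : (W : Subset m) → W ∈ₗ allSubsets m
∈-allSubsets []            = here refl
∈-allSubsets (inside  ∷ W) = ∈-++⁺ˡ (∈-map⁺ (inside ∷_) (∈-allSubsets W))
∈-allSubsets {suc m} (outside ∷ W) =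
  ∈-++⁺ʳ (map (inside ∷_) (allSubsets m)) (∈-map⁺ (outside ∷_) (∈-allSubsets W))

f≤maxUpTo : (f : ℕ → ℕ) {i m : ℕ} → 1 ≤ i → i ≤ m → f i ≤ maxUpTo f m
f≤maxUpTo f 1≤i i≤m = go 1≤i (≤⇒≤′ i≤m)
  where
  go : ∀ {i m} → 1 ≤ i → i ≤′ m → f i ≤ maxUpTo f m
  go {suc i} _ ≤′-refl = m≤m⊔n (f (suc i)) _
  go 1≤i (≤′-step i≤′m) = ≤-trans (go 1≤i i≤′m) (m≤n⊔m _ _)

maxUpTo-attained : (f : ℕ → ℕ) (m : ℕ) → 1 ≤ m → ∃[ k ] 1 ≤ k × k ≤ m × f k ≡ maxUpTo f m
maxUpTo-attained f (suc zero) _ = 1 , ≤-refl , ≤-refl , sym (⊔-identityʳ (f 1))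
maxUpTo-attained f (suc (suc m)) _
  with maxUpTo-attained f (suc m) (s≤s z≤n) | ≤-total (maxUpTo f (suc m)) (f (suc (suc m)))
... | _ | inj₁ max≤f = suc (suc m) , s≤s z≤n , ≤-refl , sym (m≥n⇒m⊔n≡m max≤f)
... | k , 1≤k , k≤m , fk≡max | inj₂ f≤max =
  k , 1≤k , m≤n⇒m≤1+n k≤m , trans fk≡max (sym (m≤n⇒m⊔n≡n f≤max))

foldr-invariant : {A B : Set} {F : A → B → B} (P : B → Set) →
  (∀ x {r} → P r → P (F x r)) → ∀ {z} → P z → ∀ xs → P (foldr F z xs)
foldr-invariant P pres Pz []       = Pz
foldr-invariant P pres Pz (x ∷ xs) = pres x (foldr-invariant P pres Pz xs)

foldr-≤-member : {A : Set} {F : A → ℕ → ℕ} → (∀ x r → F x r ≤ r) →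
  ∀ {x b} z {xs} → x ∈ₗ xs → (∀ r → F x r ≤ b) → foldr F z xs ≤ b
foldr-≤-member F-≤ z (here refl) Fx≤b = Fx≤b _
foldr-≤-member F-≤ z (there x∈xs) Fx≤b =
  ≤-trans (F-≤ _ _) (foldr-≤-member F-≤ z x∈xs Fx≤b)

-- The step function folded in the definition of mun is local to its where-block;
-- it is recovered here by unification with the unfolding of mun.
private
  foldedFunction : {A B : Set} {F : A → B → B} (z : B) (xs : List A) →
    foldr F z xs ≡ foldr F z xs → A → B → B
  foldedFunction {F = F} _ _ _ = F

module _ (G : Graph) where

  N⁻ : {x : Fin (n G)} {S : Subset (n G)} →
    x ∈ N[ G ] S → x ∈ S ⊎ ∃[ u ] u ∈ S × T (adj G u x)
  N⁻ {x} {S} x∈N with to T-∨ (to ∈-tabulate x∈N)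
  ... | inj₁ x∈S = inj₁ (from ∈⇔T-lookup x∈S)
  ... | inj₂ t =
    let u , _ , u∈S∧adj = find (any⁻ (λ u → lookup S u ∧ adj G u x) (allFin (n G)) t)
        u∈S , adj = to T-∧ u∈S∧adj
    in  inj₂ (u , from ∈⇔T-lookup u∈S , adj)

  N⁺ : {x : Fin (n G)} {S : Subset (n G)} →
    x ∈ S ⊎ ∃[ u ] u ∈ S × T (adj G u x) → x ∈ N[ G ] S
  N⁺ (inj₁ x∈S) = from ∈-tabulate (from T-∨ (inj₁ (to ∈⇔T-lookup x∈S)))
  N⁺ (inj₂ (u , u∈S , adj)) = from ∈-tabulate (from T-∨ (inj₂
    (any⁺ _ (lose (∈-allFin u) (from T-∧ (to ∈⇔T-lookup u∈S , adj))))))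

  ⊆-N : {S : Subset (n G)} → S ⊆ N[ G ] S
  ⊆-N x∈S = N⁺ (inj₁ x∈S)

  N-mono : {S S′ : Subset (n G)} → S ⊆ S′ → N[ G ] S ⊆ N[ G ] S′
  N-mono S⊆S′ x∈N with N⁻ x∈N
  ... | inj₁ x∈S             = N⁺ (inj₁ (S⊆S′ x∈S))
  ... | inj₂ (u , u∈S , adj) = N⁺ (inj₂ (u , S⊆S′ u∈S , adj))

  ∉N[⊥] : {x : Fin (n G)} → x ∉ N[ G ] ⊥
  ∉N[⊥] x∈N = [ ∉⊥ , (λ (_ , u∈⊥ , _) → ∉⊥ u∈⊥) ]′ (N⁻ x∈N)

  ∈-removeShot : {x : Fin (n G)} {R : Subset (n G)} {H : List (Fin (n G))} →
    x ∈ removeShot G R H ⇔ (x ∈ R × x ∉ₗ H)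
  ∈-removeShot = mk⇔
    (λ x∈ → let x∈R , t = to T-∧ (to ∈-tabulate x∈) in
      from ∈⇔T-lookup x∈R , λ x∈H → T-not⇒¬T t (to ∈ₗ⇔T-any x∈H))
    (λ (x∈R , x∉H) → from ∈-tabulate (from T-∧
      (to ∈⇔T-lookup x∈R , ¬T⇒T-not (λ t → x∉H (from ∈ₗ⇔T-any t)))))
    where
    T-not⇒¬T : ∀ {b} → T (not b) → ¬ T b
    T-not⇒¬T {false} _ ()
    ¬T⇒T-not : ∀ {b} → ¬ T b → T (not b)
    ¬T⇒T-not {true}  ¬t = ¬t _
    ¬T⇒T-not {false} _  = _

  private
    munStep : ℕ → Subset (n G) → ℕ → ℕ
    munStep k = foldedFunction (n G) (allSubsets (n G)) (refl {x = mun G k})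

    munStep-≤ : ∀ k W r → munStep k W r ≤ r
    munStep-≤ k W r with ∣ W ∣ ℕ.≟ k
    ... | yes _ = m⊓n≤n _ r
    ... | no  _ = ≤-refl

    munStep-≤-∣N∣ : ∀ {k W} r → ∣ W ∣ ≡ k → munStep k W r ≤ ∣ N[ G ] W ∣
    munStep-≤-∣N∣ {k} {W} r ∣W∣≡k with ∣ W ∣ ℕ.≟ k
    ... | yes _     = m⊓n≤m _ r
    ... | no ∣W∣≢k = contradiction ∣W∣≡k ∣W∣≢k

    munStep-≥ : ∀ {k} W {r} → k ≤ r → k ≤ munStep k W r
    munStep-≥ {k} W k≤r with ∣ W ∣ ℕ.≟ k
    ... | yes refl = ⊓-glb (p⊆q⇒∣p∣≤∣q∣ (⊆-N {S = W})) k≤r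
    ... | no  _    = k≤r

  mun≤n : ∀ k → mun G k ≤ n G
  mun≤n k = foldr-invariant (_≤ n G) (λ W → ≤-trans (munStep-≤ k W _)) ≤-refl (allSubsets (n G))

  k≤mun : ∀ {k} → k ≤ n G → k ≤ mun G k
  k≤mun {k} k≤n = foldr-invariant (k ≤_) munStep-≥ k≤n (allSubsets (n G))

  mun≤∣N∣ : ∀ {k W} → ∣ W ∣ ≡ k → mun G k ≤ ∣ N[ G ] W ∣
  mun≤∣N∣ {k} {W} ∣W∣≡k = foldr-≤-member (munStep-≤ k) (n G) (∈-allSubsets W)
    (λ r → munStep-≤-∣N∣ {W = W} r ∣W∣≡k)

  maxGrowth : ℕ
  maxGrowth = maxUpTo (λ k → mun G k ∸ k) (n G)

  mun≤k+maxGrowth : ∀ {k} → 1 ≤ k → k ≤ n G → mun G k ≤ k + maxGrowth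
  mun≤k+maxGrowth {k} 1≤k k≤n = begin
    mun G k             ≤⟨ m≤n+m∸n (mun G k) k ⟩
    k + (mun G k ∸ k)   ≤⟨ +-monoʳ-≤ k (f≤maxUpTo (λ k → mun G k ∸ k) 1≤k k≤n) ⟩
    k + maxGrowth       ∎
    where open ≤-Reasoning

  ∣R∣≤∣removeShot∣+length : ∀ (R : Subset (n G)) H → ∣ R ∣ ≤ ∣ removeShot G R H ∣ + length H
  ∣R∣≤∣removeShot∣+length R [] =
    ≤-trans (p⊆q⇒∣p∣≤∣q∣ R⊆R∖[]) (m≤m+n _ 0)
    where
    R⊆R∖[] : R ⊆ removeShot G R []
    R⊆R∖[] x∈R = from (∈-removeShot {R = R} {H = []}) (x∈R , λ ())
  ∣R∣≤∣removeShot∣+length R (h ∷ H) = begin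
    ∣ R ∣                                  ≤⟨ ∣R∣≤∣removeShot∣+length R H ⟩
    ∣ removeShot G R H ∣ + length H         ≤⟨ +-monoˡ-≤ (length H) shotAtMostOne ⟩
    ∣ removeShot G R (h ∷ H) ∣ + 1 + length H ≡⟨ +-assoc _ 1 (length H) ⟩
    ∣ removeShot G R (h ∷ H) ∣ + length (h ∷ H) ∎
    where
    open ≤-Reasoning
    ⊆-∪⁅h⁆ : removeShot G R H ⊆ removeShot G R (h ∷ H) ∪ ⁅ h ⁆
    ⊆-∪⁅h⁆ {x} x∈ with to (∈-removeShot {R = R} {H = H}) x∈ | x ≟ h
    ... | _          | yes refl = x∈p∪q⁺ (inj₂ (x∈⁅x⁆ x))
    ... | x∈R , x∉H | no x≢h  = x∈p∪q⁺ (inj₁ (from (∈-removeShot {R = R} {H = h ∷ H}) (x∈R , λ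
      { (here x≡h) → x≢h x≡h ; (there x∈H) → x∉H x∈H })))
    shotAtMostOne : ∣ removeShot G R H ∣ ≤ ∣ removeShot G R (h ∷ H) ∣ + 1
    shotAtMostOne = begin
      ∣ removeShot G R H ∣                           ≤⟨ p⊆q⇒∣p∣≤∣q∣ ⊆-∪⁅h⁆ ⟩
      ∣ removeShot G R (h ∷ H) ∪ ⁅ h ⁆ ∣              ≤⟨ ∣p∪q∣≤∣p∣+∣q∣ (removeShot G R (h ∷ H)) ⁅ h ⁆ ⟩
      ∣ removeShot G R (h ∷ H) ∣ + ∣ ⁅ h ⁆ ∣          ≡⟨ cong (∣ removeShot G R (h ∷ H) ∣ +_) (∣⁅x⁆∣≡1 h) ⟩
      ∣ removeShot G R (h ∷ H) ∣ + 1                 ∎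

  mun≤∣step∣ : ∀ {k} (R : Subset (n G)) H → k + length H ≤ ∣ R ∣ → mun G k ≤ ∣ step G R H ∣
  mun≤∣step∣ {k} R H k+∣H∣≤∣R∣ =
    let W , W⊆ , ∣W∣≡k = subset-ofSize (removeShot G R H) k≤∣R∖H∣
    in  ≤-trans (mun≤∣N∣ {W = W} ∣W∣≡k) (p⊆q⇒∣p∣≤∣q∣ (N-mono {S = W} W⊆))
    where
    k≤∣R∖H∣ : k ≤ ∣ removeShot G R H ∣
    k≤∣R∖H∣ = +-cancelʳ-≤ (length H) k _
      (≤-trans k+∣H∣≤∣R∣ (∣R∣≤∣removeShot∣+length R H))

  mun≤∣R∣⇒R≢⊥ : ∀ {k} {R : Subset (n G)} → 1 ≤ k → k ≤ n G → mun G k ≤ ∣ R ∣ → R ≢ ⊥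
  mun≤∣R∣⇒R≢⊥ {k} 1≤k k≤n mun≤∣⊥∣ refl = contradiction 1≤0 λ ()
    where
    1≤0 : 1 ≤ 0
    1≤0 = ≤-trans 1≤k (≤-trans (k≤mun k≤n) (≤-trans mun≤∣⊥∣ (≤-reflexive (∣⊥∣≡0 (n G)))))

  rabbit-escapes : ∀ {k} → 1 ≤ k → k ≤ n G → ∀ {R : Subset (n G)} (H : Strategy G) →
    mun G k ≤ ∣ R ∣ → width G H ≤ mun G k ∸ k → ¬ Any (_≡ ⊥) (scanl (step G) R H)
  rabbit-escapes 1≤k k≤n []      mun≤∣R∣ _ (here R≡⊥) = mun≤∣R∣⇒R≢⊥ 1≤k k≤n mun≤∣R∣ R≡⊥
  rabbit-escapes 1≤k k≤n (_ ∷ _) mun≤∣R∣ _ (here R≡⊥) = mun≤∣R∣⇒R≢⊥ 1≤k k≤n mun≤∣R∣ R≡⊥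
  rabbit-escapes {k} 1≤k k≤n {R} (h ∷ H) mun≤∣R∣ width≤ (there caught) =
    rabbit-escapes 1≤k k≤n H (mun≤∣step∣ R h k+∣h∣≤∣R∣) (≤-trans (m≤n⊔m _ _) width≤) caught
    where
    k+∣h∣≤∣R∣ : k + length h ≤ ∣ R ∣
    k+∣h∣≤∣R∣ = begin
      k + length h        ≤⟨ +-monoʳ-≤ k (≤-trans (m≤m⊔n _ _) width≤) ⟩
      k + (mun G k ∸ k)   ≡⟨ m+[n∸m]≡n (k≤mun k≤n) ⟩
      mun G k             ≤⟨ mun≤∣R∣ ⟩
      ∣ R ∣               ∎
      where open ≤-Reasoning

  maxGrowth<width : 1 ≤ n G → (H : Strategy G) → Winning G H → maxGrowth < width G H
  maxGrowth<width 1≤n H winning with maxUpTo-attained (λ k → mun G k ∸ k) (n G) 1≤n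
  ... | k , 1≤k , k≤n , growth≡max = ≰⇒> λ width≤maxGrowth →
    rabbit-escapes 1≤k k≤n H (≤-trans (mun≤n k) (≤-reflexive (sym (∣⊤∣≡n (n G)))))
      (subst (width G H ≤_) (sym growth≡max) width≤maxGrowth) winning

module _ (G : Graph) {Gs : ℕ → Subset (n G)} (nesting : IsNesting G Gs) where

  private
    d : ℕ
    d = maxGrowth G

  -- IsNesting leaves Gs 0 unconstrained; chain puts G₀ = ∅ there, which is also
  -- what chain (j ∸ (d + 1)) becomes in the last d + 1 rounds.
  chain : ℕ → Subset (n G)
  chain zero    = ⊥
  chain (suc i) = Gs (suc i)

  ∣chain∣ : ∀ {i} → i ≤ n G → ∣ chain i ∣ ≡ i
  ∣chain∣ {zero}  _   = ∣⊥∣≡0 (n G)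
  ∣chain∣ {suc i} i≤n = proj₁ (nesting (suc i) (s≤s z≤n) i≤n)

  chain≡Gs : ∀ {i} → 1 ≤ i → chain i ≡ Gs i
  chain≡Gs {suc i} _ = refl

  chain-step : ∀ {i} → suc i ≤ n G → chain i ⊆ chain (suc i)
  chain-step {zero}  _    = ⊥⊆
  chain-step {suc i} i<n = proj₁ (proj₂ (nesting (suc i) (s≤s z≤n) (<⇒≤ i<n))) i<n

  chain-mono : ∀ {i j} → i ≤ j → j ≤ n G → chain i ⊆ chain j
  chain-mono i≤j = go (≤⇒≤′ i≤j)
    where
    go : ∀ {i j} → i ≤′ j → j ≤ n G → chain i ⊆ chain j
    go ≤′-refl              _    = ⊆-refl
    go (≤′-step i≤′j) j<n = ⊆-trans (go i≤′j (<⇒≤ j<n)) (chain-step j<n)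

  N-chain≡chain-mun : ∀ {i} → 1 ≤ i → i ≤ n G → N[ G ] (chain i) ≡ chain (mun G i)
  N-chain≡chain-mun {suc i} _ i≤n with nesting (suc i) (s≤s z≤n) i≤n
  ... | _ , _ , ∣N∣≡mun , N≡Gs = begin
    N[ G ] (Gs (suc i))          ≡⟨ N≡Gs ⟩
    Gs ∣ N[ G ] (Gs (suc i)) ∣   ≡⟨ cong Gs ∣N∣≡mun ⟩
    Gs (mun G (suc i))           ≡⟨ sym (chain≡Gs (≤-trans (s≤s z≤n) (k≤mun G i≤n))) ⟩
    chain (mun G (suc i))        ∎
    where open ≡-Reasoning

  N-chain⊆ : ∀ i {j} → i ≤ j ∸ d → j ≤ n G → N[ G ] (chain i) ⊆ chain j
  N-chain⊆ zero _ _ x∈N = contradiction x∈N (∉N[⊥] G)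
  N-chain⊆ (suc i) {j} i<j∸d j≤n =
    subst (_⊆ chain j) (sym (N-chain≡chain-mun (s≤s z≤n) i<n)) (chain-mono mun≤j j≤n)
    where
    i<n : suc i ≤ n G
    i<n = ≤-trans (≤-trans i<j∸d (m∸n≤m j d)) j≤n
    d<j : d < j
    d<j = m∸n≢0⇒n<m λ j∸d≡0 → contradiction (subst (suc i ≤_) j∸d≡0 i<j∸d) λ ()
    mun≤j : mun G (suc i) ≤ j
    mun≤j = begin
      mun G (suc i) ≤⟨ mun≤k+maxGrowth G (s≤s z≤n) i<n ⟩
      suc i + d     ≤⟨ m≤o∸n⇒m+n≤o (suc i) (<⇒≤ d<j) i<j∸d ⟩
      j             ∎
      where open ≤-Reasoning

  shots : ℕ → List (Fin (n G))
  shots j = elements (chain j ─ chain (j ∸ suc d))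

  length-shots : ∀ {j} → j ≤ n G → length (shots j) ≤ suc d
  length-shots {j} j≤n = begin
    length (shots j)                            ≡⟨ length-elements (chain j ─ chain (j ∸ suc d)) ⟩
    ∣ chain j ─ chain (j ∸ suc d) ∣             ≡⟨ ∣p─q∣≡∣p∣∸∣q∣ lower⊆chain ⟩
    ∣ chain j ∣ ∸ ∣ chain (j ∸ suc d) ∣         ≡⟨ cong₂ _∸_ (∣chain∣ j≤n)
                                                     (∣chain∣ (≤-trans (m∸n≤m j (suc d)) j≤n)) ⟩
    j ∸ (j ∸ suc d)                             ≤⟨ m≤n+o⇒m∸n≤o j (j ∸ suc d) j≤[j∸D]+D ⟩
    suc d                                       ∎
    where
    open ≤-Reasoning
    lower⊆chain : chain (j ∸ suc d) ⊆ chain j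
    lower⊆chain = chain-mono (m∸n≤m j (suc d)) j≤n
    j≤[j∸D]+D : j ≤ (j ∸ suc d) + suc d
    j≤[j∸D]+D = subst (j ≤_) (+-comm (suc d) (j ∸ suc d)) (m≤n+m∸n j (suc d))

  step-shots⊆ : ∀ {j} {R : Subset (n G)} → suc j ≤ n G → R ⊆ chain (suc j) →
    step G R (shots (suc j)) ⊆ chain j
  step-shots⊆ {j} {R} j<n R⊆ =
    ⊆-trans (N-mono G survivors⊆) (N-chain⊆ (j ∸ d) ≤-refl (<⇒≤ j<n))
    where
    survivors⊆ : removeShot G R (shots (suc j)) ⊆ chain (j ∸ d)
    survivors⊆ {x} x∈ with to (∈-removeShot G {R = R} {H = shots (suc j)}) x∈ | x ∈? chain (j ∸ d)
    ... | _          | yes x∈lower = x∈lower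
    ... | x∈R , x∉H | no  x∉lower = contradiction (∈-elements (x∈p∧x∉q⇒x∈p─q (R⊆ x∈R) x∉lower)) x∉H

  strategy : ℕ → Strategy G
  strategy zero    = []
  strategy (suc j) = shots (suc j) ∷ strategy j

  strategy-catches : ∀ j {R : Subset (n G)} → j ≤ n G → R ⊆ chain j →
    Any (_≡ ⊥) (scanl (step G) R (strategy j))
  strategy-catches zero    _   R⊆⊥ = here (⊆-antisym R⊆⊥ ⊥⊆)
  strategy-catches (suc j) j<n R⊆  =
    there (strategy-catches j (<⇒≤ j<n) (step-shots⊆ j<n R⊆))

  width-strategy : ∀ j → j ≤ n G → width G (strategy j) ≤ suc d
  width-strategy zero    _   = z≤n
  width-strategy (suc j) j<n = ⊔-lub (length-shots j<n) (width-strategy j (<⇒≤ j<n))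

  strategy-wins : Winning G (strategy (n G))
  strategy-wins = strategy-catches (n G) ≤-refl
    (⊆-reflexive (sym (∣p∣≡n⇒p≡⊤ (∣chain∣ ≤-refl))))

theorem5p3 : (G : Graph) → 1 ≤ n G → HasClosedIsoperimetricNesting G →
    IsHun G (suc (maxUpTo (λ k → mun G k ∸ k) (n G)))
theorem5p3 G 1≤n (_ , nesting) =
  (strategy G nesting (n G) , strategy-wins G nesting , width≡) , maxGrowth<width G 1≤n
  where
  width≡ : width G (strategy G nesting (n G)) ≡ suc (maxGrowth G)
  width≡ = ≤-antisym (width-strategy G nesting (n G) ≤-refl)
                     (maxGrowth<width G 1≤n _ (strategy-wins G nesting))
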